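{- Let $L$ be a lattice. The following are equivalent: (1) for all $a,b\in L$ with $a\not\leq b$ and all $3\leq m,k\leq\omega$, $\exists$ has an $\omega$-strategy in the $(m,k)$-game on $L$ with starting position $(\{a\},\{b\})$; (2) for all $a,b\in L$ with $a\not\leq b$, $\exists$ has a $5$-strategy in the $(3,3)$-game on $L$ with starting position $(\{a\},\{b\})$; (3) $L$ is distributive.
   Context: The $(\alpha,\beta)$-game on a poset $P$ with starting position $(U_0,V)$ is played by $\forall$ and $\exists$ in rounds $0,1,2,\dots$; a set $U$ starts as $U_0$. $\forall$ wins in round $n$ if $U\cap V\neq\emptyset$ at the beginning of round $n$. In each round $\forall$ makes one of the moves: (1) pick $b\in P$ with $b\geq a$ for some $a\in U$; $\exists$ must add $b$ to $U$. (2) pick $A\subseteq U$ with $|A|<\alpha$ such that $\bigwedge A$ exists in $P$; $\exists$ must add $\bigwedge A$ to $U$. (3) pick $B\subseteq P$ with $|B|<\beta$ such that $\bigvee B$ exists in $P$ and lies in $U$; $\exists$ must choose some $b\in B$ and add it to $U$. $\exists$ has an $n$-strategy if she can guarantee that $\forall$ does not win in any round $\leq n$; she has an $\omega$-strategy if she can guarantee $\forall$ never wins. -}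

module Defs where

open import Level using (Level; _⊔_; Lift) renaming (suc to lsuc)
open import Data.Nat using (ℕ; zero; suc; _<_; _≤_)
open import Data.Unit using (⊤)
open import Data.Product using (Σ; ∃; _×_; _,_)
open import Data.List using (List; []; _∷_; length)
open import Data.List.Relation.Unary.All using (All)
open import Data.List.Relation.Unary.Any using (Any)
open import Relation.Nullary using (¬_)
open import Relation.Binary.Lattice using (Lattice; IsDistributiveLattice)

-- Cardinal bounds 3 ≤ α ≤ ω: either a finite cardinal n or ω.
data Card : Set where
  fin : ℕ → Card
  ω   : Card

_<ᶜ_ : ℕ → Card → Set
k <ᶜ fin n = k < n
k <ᶜ ω     = ⊤

_≤ᶜ_ : ℕ → Card → Set
k ≤ᶜ fin n = k ≤ n
k ≤ᶜ ω     = ⊤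

module Game {c ℓ₁ ℓ₂ : Level} (L : Lattice c ℓ₁ ℓ₂) where
  open Lattice L using (Carrier; _≈_; _∨_; _∧_) renaming (_≤_ to _⊑_)

  -- membership in a finite set (represented by a list), up to the lattice equality
  _∈_ : Carrier → List Carrier → Set (c ⊔ ℓ₁)
  x ∈ U = Any (x ≈_) U

  IsMeetOf : Carrier → List Carrier → Set (c ⊔ ℓ₂)
  IsMeetOf x A = All (x ⊑_) A × (∀ y → All (y ⊑_) A → y ⊑ x)

  IsJoinOf : Carrier → List Carrier → Set (c ⊔ ℓ₂)
  IsJoinOf x B = All (_⊑ x) B × (∀ y → All (_⊑ y) B → x ⊑ y)

  -- One round of the (α,β)-game with target V = {v}, current set U.
  -- `Respond α β P U`: for every move of ∀ at position U, ∃ has a legal answer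
  -- such that the resulting set satisfies P.
  -- (Sets of size < α are represented by lists of length < α; a list with
  -- repetitions represents a set with fewer elements, so this is the same.)
  Respond : {ℓ : Level} → Card → Card → (List Carrier → Set ℓ) → List Carrier
          → Set (c ⊔ ℓ₁ ⊔ ℓ₂ ⊔ ℓ)
  Respond α β P U =
      (∀ (x : Carrier) → Σ Carrier (λ y → y ∈ U × y ⊑ x) → P (x ∷ U))
    ×
      (∀ (A : List Carrier) (m : Carrier) → length A <ᶜ α → All (_∈ U) A
         → IsMeetOf m A → P (m ∷ U))
    ×
      (∀ (B : List Carrier) (j : Carrier) → length B <ᶜ β → IsJoinOf j B
         → j ∈ U → Σ Carrier (λ x → x ∈ B × P (x ∷ U)))

  -- ∃ survives the rounds 0,…,n (∀ does not win in any round ≤ n)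
  -- starting from U, with V = {v}.
  Survives : Card → Card → Carrier → ℕ → List Carrier → Set (c ⊔ ℓ₁ ⊔ ℓ₂)
  Survives α β v zero U = Lift (c ⊔ ℓ₁ ⊔ ℓ₂) (¬ (v ∈ U))
  Survives α β v (suc n) U = ¬ (v ∈ U) × Respond α β (Survives α β v n) U

  HasNStrategy : ℕ → Card → Card → Carrier → Carrier → Set (c ⊔ ℓ₁ ⊔ ℓ₂)
  HasNStrategy n α β a b = Survives α β b n (a ∷ [])

  -- ∃ has an ω-strategy in the (α,β)-game with starting position ({a},{b}):
  -- there is a set S of positions, containing the start, in which ∀ has not won,
  -- and from which ∃ can answer every move of ∀ staying inside S.
  HasωStrategy : Card → Card → Carrier → Carrier → Set (lsuc (c ⊔ ℓ₁ ⊔ ℓ₂))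
  HasωStrategy α β a b =
    Σ (List Carrier → Set (c ⊔ ℓ₁ ⊔ ℓ₂)) λ S →
        S (a ∷ [])
      × (∀ U → S U → ¬ (b ∈ U))
      × (∀ U → S U → Respond α β S U)

  Cond1 : Set (lsuc (c ⊔ ℓ₁ ⊔ ℓ₂))
  Cond1 = ∀ (a b : Carrier) → ¬ (a ⊑ b) → (m k : Card) → 3 ≤ᶜ m → 3 ≤ᶜ k
            → HasωStrategy m k a b

  Cond2 : Set (c ⊔ ℓ₁ ⊔ ℓ₂)
  Cond2 = ∀ (a b : Carrier) → ¬ (a ⊑ b) → HasNStrategy 5 (fin 3) (fin 3) a b

  Cond3 : Set (c ⊔ ℓ₁ ⊔ ℓ₂)
  Cond3 = IsDistributiveLattice _≈_ _⊑_ _∨_ _∧_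

module Submission where

-- In a distributive lattice, ∃ keeps the invariant
--   "some lower bound m of U satisfies m ⋢ b"  (U is guarded).
-- Moves (1) and (2) keep m as a lower bound.  For move (3), if ⋁B ∈ U then
-- m ⊑ ⋁B, and distributivity (plus excluded middle, to locate the element)
-- yields x ∈ B with m ∧ x ⋢ b, so ∃ adds x and m ∧ x is the new witness.
-- Since b has no guarded lower bound, b never enters U.
--
-- Cond1 → Cond2.  An ω-strategy is an invariant, and an invariant yields an
-- n-strategy for every n, in particular in the (3,3)-game for n = 5.
--
-- In ANY lattice ∀ wins the (3,3)-game from
-- ({x ∧ (y ∨ z)}, {(x ∧ y) ∨ (x ∧ z)}) by round 5: he adds x and y ∨ z,
-- splits y ∨ z into some w ∈ {y, z}, adds x ∧ w, and then the target above it.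
-- Hence, by Cond2 and double negation elimination, x ∧ (y ∨ z) ⊑ (x ∧ y) ∨ (x ∧ z);
-- the converse inequality holds in every lattice.

open import Defs
open import Level using (Level; Lift; lift; lower; _⊔_)
open import Data.Product using (_×_; Σ; _,_)
open import Relation.Binary.Lattice using (Lattice; IsDistributiveLattice)
open import Axiom.ExcludedMiddle using (ExcludedMiddle)
open import Axiom.DoubleNegationElimination using (em⇒dne)
open import Data.List using (List; []; _∷_; length; foldr)
open import Data.List.Relation.Unary.All as All using (All; []; _∷_)
open import Data.List.Relation.Unary.All.Properties using (¬All⇒Any¬)
open import Data.List.Relation.Unary.Any using (here; there)
open import Data.Nat using (zero; suc)
open import Data.Nat.Properties using (≤-refl; n<1+n)
open import Relation.Nullary using (¬_)

module LatticeGames {c ℓ₁ ℓ₂ : Level} (L : Lattice c ℓ₁ ℓ₂) where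
  open Lattice L renaming (_≤_ to _⊑_)
  open Game L
  open import Data.List.Membership.Setoid setoid using (find)

  lowerBound-∈ : ∀ {m x U} → All (m ⊑_) U → x ∈ U → m ⊑ x
  lowerBound-∈ (m⊑u ∷ _) (here x≈u) = ≤-respʳ-≈ (Eq.sym x≈u) m⊑u
  lowerBound-∈ (_ ∷ m⊑U) (there x∈U) = lowerBound-∈ m⊑U x∈U

  ∧-isMeet : ∀ x y → IsMeetOf (x ∧ y) (x ∷ y ∷ [])
  ∧-isMeet x y = (x∧y≤x x y ∷ x∧y≤y x y ∷ []) , λ { _ (u⊑x ∷ u⊑y ∷ []) → ∧-greatest u⊑x u⊑y }

  ∨-isJoin : ∀ x y → IsJoinOf (x ∨ y) (x ∷ y ∷ [])
  ∨-isJoin x y = (x≤x∨y x y ∷ y≤x∨y x y ∷ []) , λ { _ (x⊑u ∷ y⊑u ∷ []) → ∨-least x⊑u y⊑u }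

  distrib-≥ : ∀ x y z → (x ∧ y) ∨ (x ∧ z) ⊑ x ∧ (y ∨ z)
  distrib-≥ x y z =
    ∨-least (∧-greatest (x∧y≤x x y) (trans (x∧y≤y x y) (x≤x∨y y z)))
            (∧-greatest (x∧y≤x x z) (trans (x∧y≤y x z) (y≤x∨y y z)))

  IsInvariant : Card → Card → Carrier → (List Carrier → Set (c ⊔ ℓ₁ ⊔ ℓ₂)) → Set (c ⊔ ℓ₁ ⊔ ℓ₂)
  IsInvariant α β b S = (∀ U → S U → ¬ (b ∈ U)) × (∀ U → S U → Respond α β S U)

  invariant⇒survives : ∀ {α β b S} → IsInvariant α β b S → ∀ n U → S U → Survives α β b n U
  invariant⇒survives (avoids , _) zero U s = lift (avoids U s)
  invariant⇒survives {S = S} inv@(avoids , respond) (suc n) U s =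
    let (up , meet , split) = respond U s
        continue : ∀ {V} → S V → Survives _ _ _ n V
        continue = invariant⇒survives inv n _
    in avoids U s
     , (λ x y≤x → continue (up x y≤x))
     , (λ A m |A| A⊆U isMeet → continue (meet A m |A| A⊆U isMeet))
     , (λ B j |B| isJoin j∈U → let (x , x∈B , s′) = split B j |B| isJoin j∈U
                               in x , x∈B , continue s′)

  ω⇒n-strategy : ∀ {α β a b} → HasωStrategy α β a b → ∀ n → HasNStrategy n α β a b
  ω⇒n-strategy (S , start , avoids , respond) n =
    invariant⇒survives (avoids , respond) n (_ ∷ []) start

  module _ {α β : Card} {v : Carrier} where
    moveUp : ∀ {n U x y} → Survives α β v (suc n) U → y ∈ U → y ⊑ x → Survives α β v n (x ∷ U)
    moveUp (_ , up , _) y∈U y⊑x = up _ (_ , y∈U , y⊑x)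

    moveMeet : ∀ {n U A m} → Survives α β v (suc n) U → length A <ᶜ α → All (_∈ U) A → IsMeetOf m A
             → Survives α β v n (m ∷ U)
    moveMeet (_ , _ , meet , _) = meet _ _

    moveJoin : ∀ {n U B j} → Survives α β v (suc n) U → length B <ᶜ β → IsJoinOf j B → j ∈ U
             → Σ Carrier λ x → x ∈ B × Survives α β v n (x ∷ U)
    moveJoin (_ , _ , _ , split) = split _ _

  ∀-wins-against-distributivity : ∀ x y z
    → ¬ HasNStrategy 5 (fin 3) (fin 3) (x ∧ (y ∨ z)) ((x ∧ y) ∨ (x ∧ z))
  ∀-wins-against-distributivity x y z s₀ =
    let
        s₁ = moveUp s₀ (here Eq.refl) (x∧y≤x x (y ∨ z))
        s₂ = moveUp s₁ (there (here Eq.refl)) (x∧y≤y x (y ∨ z))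
        -- split y ∨ z: ∃ adds some w ∈ {y, z}
        (w , w∈yz , s₃) = moveJoin s₂ (n<1+n 2) (∨-isJoin y z) (here Eq.refl)
        s₄ = moveMeet s₃ (n<1+n 2) (there (there (here Eq.refl)) ∷ here Eq.refl ∷ []) (∧-isMeet x w)
        -- add the target, which lies above x ∧ w
        s₅ = moveUp s₄ (here Eq.refl) (x∧w-below w w∈yz)
    in lower s₅ (here Eq.refl)
    where
    ∧-monoʳ : ∀ {w v} → w ⊑ v → x ∧ w ⊑ x ∧ v
    ∧-monoʳ w⊑v = ∧-greatest (x∧y≤x _ _) (trans (x∧y≤y _ _) w⊑v)

    x∧w-below : ∀ w → w ∈ (y ∷ z ∷ []) → x ∧ w ⊑ (x ∧ y) ∨ (x ∧ z)
    x∧w-below w (here w≈y) = trans (∧-monoʳ (reflexive w≈y)) (x≤x∨y _ _)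
    x∧w-below w (there (here w≈z)) = trans (∧-monoʳ (reflexive w≈z)) (y≤x∨y _ _)

  module Distributive (em : ∀ {ℓ} → ExcludedMiddle ℓ) (dist : Cond3) (b : Carrier) where

    joinWith-b : List Carrier → Carrier
    joinWith-b = foldr _∨_ b

    b⊑joinWith-b : ∀ B → b ⊑ joinWith-b B
    b⊑joinWith-b [] = refl
    b⊑joinWith-b (x ∷ B) = trans (b⊑joinWith-b B) (y≤x∨y x _)

    B⊑joinWith-b : ∀ B → All (_⊑ joinWith-b B) B
    B⊑joinWith-b [] = []
    B⊑joinWith-b (x ∷ B) = x≤x∨y x _ ∷ All.map (λ p → trans p (y≤x∨y x _)) (B⊑joinWith-b B)

    meet-joinWith-b : ∀ m B → All (λ x → m ∧ x ⊑ b) B → m ∧ joinWith-b B ⊑ b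
    meet-joinWith-b m [] _ = x∧y≤y m b
    meet-joinWith-b m (x ∷ B) (m∧x⊑b ∷ rest) =
      trans (reflexive (IsDistributiveLattice.∧-distribˡ-∨ dist m x (joinWith-b B)))
            (∨-least m∧x⊑b (meet-joinWith-b m B rest))

    prime-split : ∀ {m j} B → IsJoinOf j B → m ⊑ j → ¬ (m ⊑ b)
                → Σ Carrier λ x → x ∈ B × ¬ (m ∧ x ⊑ b)
    prime-split {m} {j} B (_ , least) m⊑j m⋢b =
      find (¬All⇒Any¬ (λ _ → em) B all-below)
      where
      all-below : ¬ All (λ x → m ∧ x ⊑ b) B
      all-below below = m⋢b (trans (∧-greatest refl (trans m⊑j (least _ (B⊑joinWith-b B))))
                                   (meet-joinWith-b m B below))

    Guarded : List Carrier → Set (c ⊔ ℓ₁ ⊔ ℓ₂)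
    Guarded U = Lift (c ⊔ ℓ₁ ⊔ ℓ₂) (Σ Carrier λ m → All (m ⊑_) U × ¬ (m ⊑ b))

    guarded-avoids : ∀ U → Guarded U → ¬ (b ∈ U)
    guarded-avoids U (lift (m , m⊑U , m⋢b)) b∈U = m⋢b (lowerBound-∈ m⊑U b∈U)

    guarded-respond : ∀ {α β} U → Guarded U → Respond α β Guarded U
    guarded-respond U (lift (m , m⊑U , m⋢b)) =
        (λ x (_ , y∈U , y⊑x) → lift (m , trans (lowerBound-∈ m⊑U y∈U) y⊑x ∷ m⊑U , m⋢b))
      , (λ A _ _ A⊆U (_ , greatest) → lift (m , greatest m (All.map (lowerBound-∈ m⊑U) A⊆U) ∷ m⊑U , m⋢b))
      , λ B _ _ isJoin j∈U →
          let (x , x∈B , m∧x⋢b) = prime-split B isJoin (lowerBound-∈ m⊑U j∈U) m⋢b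
          in x , x∈B , lift (m ∧ x , x∧y≤y m x ∷ All.map (trans (x∧y≤x m x)) m⊑U , m∧x⋢b)

    guarded-invariant : ∀ {α β} → IsInvariant α β b Guarded
    guarded-invariant = guarded-avoids , guarded-respond

  module Equivalences (em : ∀ {ℓ} → ExcludedMiddle ℓ) where
    cond3⇒cond1 : Cond3 → Cond1
    cond3⇒cond1 dist a b a⋢b _ _ _ _ =
      Guarded , lift (a , refl ∷ [] , a⋢b) , guarded-invariant
      where open Distributive em dist b

    cond1⇒cond2 : Cond1 → Cond2
    cond1⇒cond2 h a b a⋢b = ω⇒n-strategy (h a b a⋢b (fin 3) (fin 3) ≤-refl ≤-refl) 5

    cond2⇒cond3 : Cond2 → Cond3
    cond2⇒cond3 h = record { isLattice = isLattice ; ∧-distribˡ-∨ = distrib }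
      where
      distrib : ∀ x y z → x ∧ (y ∨ z) ≈ (x ∧ y) ∨ (x ∧ z)
      distrib x y z =
        antisym (em⇒dne em λ a⋢b → ∀-wins-against-distributivity x y z (h _ _ a⋢b))
                (distrib-≥ x y z)

corollary6p3 : {c ℓ₁ ℓ₂ : Level} → (∀ {ℓ} → ExcludedMiddle ℓ) → (L : Lattice c ℓ₁ ℓ₂)
    → ((Game.Cond1 L → Game.Cond3 L) × (Game.Cond3 L → Game.Cond1 L))
    × ((Game.Cond2 L → Game.Cond3 L) × (Game.Cond3 L → Game.Cond2 L))
corollary6p3 em L =
    ((λ c1 → cond2⇒cond3 (cond1⇒cond2 c1)) , cond3⇒cond1)
  , (cond2⇒cond3 , λ c3 → cond1⇒cond2 (cond3⇒cond1 c3))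
  where open LatticeGames.Equivalences L em
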